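{- Let $G$ be a finite simple graph with $|E(G)| \le 2|V(G)| - 1$ and minimum degree $\delta(G) \ge 2$. Then there exists a vertex $v$ of $G$, of degree $k = \deg(v)$, such that at least one of the following holds: (B1) $k = 2$; (B2) $k = 3$ and at least two of the neighbours of $v$ have degree at most $4$; (B3) $k = 5$ and at least three of the neighbours of $v$ have degree at most $3$; (B4) $k = 6$ and at least five of the neighbours of $v$ have degree at most $3$; (B5) $k \ge 7$ and all $k$ neighbours of $v$ have degree at most $3$.
   Context: Degrees are taken in $G$. -}

module Defs where

open import Data.Nat using (ℕ; zero; suc; _+_; _*_; _≤_; _≤ᵇ_)
open import Data.Nat.Base using (_<ᵇ_)
open import Data.Bool using (Bool; true; false; _∧_; if_then_else_)
open import Data.Fin using (Fin; toℕ)
open import Data.List using (List; length; filter; allFin; map)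
open import Data.Nat.ListAction using (sum)
open import Data.List using (filterᵇ)
open import Relation.Binary.PropositionalEquality using (_≡_)
open import Relation.Nullary using (¬_)

record SimpleGraph (n : ℕ) : Set where
  field
    adj   : Fin n → Fin n → Bool
    sym   : ∀ u v → adj u v ≡ adj v u
    irrefl : ∀ v → adj v v ≡ false

open SimpleGraph public

vertices : (n : ℕ) → List (Fin n)
vertices n = allFin n

nbrs : {n : ℕ} → SimpleGraph n → Fin n → List (Fin n)
nbrs {n} G v = filterᵇ (adj G v) (allFin n)

deg : {n : ℕ} → SimpleGraph n → Fin n → ℕ
deg G v = length (nbrs G v)

edgeCount : {n : ℕ} → SimpleGraph n → ℕ
edgeCount {n} G =
  sum (map (λ u → length (filterᵇ (λ v → (toℕ u <ᵇ toℕ v) ∧ adj G u v) (allFin n))) (allFin n))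

lowNbrs : {n : ℕ} → SimpleGraph n → Fin n → ℕ → ℕ
lowNbrs G v d = length (filterᵇ (λ u → deg G u ≤ᵇ d) (nbrs G v))

minDegAtLeast : {n : ℕ} → SimpleGraph n → ℕ → Set
minDegAtLeast G d = ∀ v → d ≤ deg G v

-- Give every vertex the charge 2 deg v - 8; by the handshaking
-- lemma the total charge is 4 |E| - 8 |V| < 0.  Let every vertex of degree at
-- least 5 send one unit to each neighbour of degree at most 3.  In a graph
-- containing none of the configurations (B1)-(B5) every vertex ends with a
-- nonnegative charge: a vertex of degree 3 has at least two neighbours of
-- degree at least 5, a vertex of degree 5, 6 or d >= 7 has at most 2, 4 or
-- d - 1 neighbours of degree at most 3.  Since the total is preserved, this
-- is a contradiction.
module Submission where

open import Defs
open import Data.Nat using (ℕ; _+_; _*_; _≤_; _∸_)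
open import Data.Fin using (Fin)
open import Data.Product using (∃; _×_)
open import Data.Sum using (_⊎_)
open import Relation.Binary.PropositionalEquality using (_≡_)

open import Algebra.Bundles using (CommutativeMonoid)
open import Data.Bool using (Bool; true; false; _∧_; not; if_then_else_; T?)
open import Data.Bool.Properties using (∧-zeroʳ; ∧-commutativeMonoid)
open import Data.Empty using (⊥-elim)
open import Data.Fin using (zero; suc; toℕ)
open import Data.Fin.Properties using (toℕ-injective; any?)
open import Data.List using ([]; _∷_; length; filterᵇ; tabulate; allFin)
open import Data.List.Properties using (map-tabulate; length-filter)
open import Data.Nat using (zero; suc; z≤n; s≤s; _<_; _≤ᵇ_; _<ᵇ_; s≤s⁻¹; _≟_; _≤?_)
open import Data.Nat.Properties
import Data.Nat.ListAction as ListAction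
open import Data.Product using (_,_)
open import Data.Sum using (inj₁; inj₂; map₁)
open import Function using (_∘_; id)
open import Relation.Binary.PropositionalEquality
  using (refl; trans; cong; cong₂; module ≡-Reasoning)
import Relation.Binary.PropositionalEquality as ≡
open import Relation.Nullary using (¬_; Dec; yes; no)
open import Relation.Nullary.Decidable using (_×-dec_; _⊎-dec_)

open import Algebra.Properties.CommutativeMonoid.Sum +-0-commutativeMonoid
  using (sum-syntax; sum-cong-≗; sum-replicate-zero; ∑-distrib-+; ∑-comm)
open import Algebra.Properties.Semiring.Sum +-*-semiring using (*-distribˡ-sum)
open import Algebra.Properties.CommutativeSemigroup
  (CommutativeMonoid.commutativeSemigroup ∧-commutativeMonoid) using (x∙yz≈z∙yx)

private
  variable
    A : Set
    n : ℕ

𝟙 : Bool → ℕ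
𝟙 b = if b then 1 else 0

𝟙-split : ∀ s x → 𝟙 x ≡ 𝟙 (s ∧ x) + 𝟙 (not s ∧ x)
𝟙-split true  x = ≡.sym (+-identityʳ (𝟙 x))
𝟙-split false x = refl

≡⊎<ᵇ-swap≡not : ∀ a b → a ≡ b ⊎ (b <ᵇ a) ≡ not (a <ᵇ b)
≡⊎<ᵇ-swap≡not zero    zero    = inj₁ refl
≡⊎<ᵇ-swap≡not zero    (suc b) = inj₂ refl
≡⊎<ᵇ-swap≡not (suc a) zero    = inj₂ refl
≡⊎<ᵇ-swap≡not (suc a) (suc b) = map₁ (cong suc) (≡⊎<ᵇ-swap≡not a b)

∑-const : ∀ n c → ∑[ i < n ] c ≡ n * c
∑-const zero    c = refl
∑-const (suc n) c = cong (c +_) (∑-const n c)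

∑-mono-≤ : {f g : Fin n → ℕ} → (∀ i → f i ≤ g i) → ∑[ i < n ] f i ≤ ∑[ i < n ] g i
∑-mono-≤ {zero}  f≤g = z≤n
∑-mono-≤ {suc n} f≤g = +-mono-≤ (f≤g zero) (∑-mono-≤ (f≤g ∘ suc))

∑-𝟙-∧ˡ : ∀ b (f : Fin n → Bool) →
         ∑[ i < n ] 𝟙 (b ∧ f i) ≡ (if b then ∑[ i < n ] 𝟙 (f i) else 0)
∑-𝟙-∧ˡ true  f = refl
∑-𝟙-∧ˡ {n} false f = sum-replicate-zero n

sum-tabulate : (f : Fin n → ℕ) → ListAction.sum (tabulate f) ≡ ∑[ i < n ] f i
sum-tabulate {zero}  f = refl
sum-tabulate {suc n} f = cong (f zero +_) (sum-tabulate (f ∘ suc))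

length-filterᵇ-∷ : ∀ (p : A → Bool) x xs →
                   length (filterᵇ p (x ∷ xs)) ≡ 𝟙 (p x) + length (filterᵇ p xs)
length-filterᵇ-∷ p x xs with p x
... | true  = refl
... | false = refl

length-filterᵇ-tabulate : ∀ (p : A → Bool) (f : Fin n → A) →
                          length (filterᵇ p (tabulate f)) ≡ ∑[ i < n ] 𝟙 (p (f i))
length-filterᵇ-tabulate {n = zero}  p f = refl
length-filterᵇ-tabulate {n = suc n} p f =
  trans (length-filterᵇ-∷ p (f zero) (tabulate (f ∘ suc)))
        (cong (𝟙 (p (f zero)) +_) (length-filterᵇ-tabulate p (f ∘ suc)))

filterᵇ-filterᵇ : ∀ (p q : A → Bool) xs →
                  filterᵇ q (filterᵇ p xs) ≡ filterᵇ (λ x → p x ∧ q x) xs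
filterᵇ-filterᵇ p q [] = refl
filterᵇ-filterᵇ p q (x ∷ xs) with p x
... | false = filterᵇ-filterᵇ p q xs
... | true with q x
...   | true  = cong (x ∷_) (filterᵇ-filterᵇ p q xs)
...   | false = filterᵇ-filterᵇ p q xs

length-filterᵇ-partition : ∀ (p : A → Bool) xs →
  length xs ≡ length (filterᵇ p xs) + length (filterᵇ (not ∘ p) xs)
length-filterᵇ-partition p [] = refl
length-filterᵇ-partition p (x ∷ xs) with p x
... | true  = cong suc (length-filterᵇ-partition p xs)
... | false = trans (cong suc (length-filterᵇ-partition p xs))
                    (≡.sym (+-suc (length (filterᵇ p xs)) _))

module _ (G : SimpleGraph n) where

  length-filterᵇ-nbrs : ∀ v (p : Fin n → Bool) →
    length (filterᵇ p (nbrs G v)) ≡ ∑[ u < n ] 𝟙 (adj G v u ∧ p u)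
  length-filterᵇ-nbrs v p = trans (cong length (filterᵇ-filterᵇ (adj G v) p (allFin n)))
                                  (length-filterᵇ-tabulate (λ u → adj G v u ∧ p u) id)

  deg≡∑ : ∀ v → deg G v ≡ ∑[ u < n ] 𝟙 (adj G v u)
  deg≡∑ v = length-filterᵇ-tabulate (adj G v) id

  ascending : Fin n → Fin n → Bool
  ascending u v = (toℕ u <ᵇ toℕ v) ∧ adj G u v

  ascendingEdge : Fin n → Fin n → ℕ
  ascendingEdge u v = 𝟙 (ascending u v)

  edgeCount≡∑ : edgeCount G ≡ ∑[ u < n ] ∑[ v < n ] ascendingEdge u v
  edgeCount≡∑ = trans (cong ListAction.sum (map-tabulate id ascendingDegree))
                      (trans (sum-tabulate ascendingDegree)
                             (sum-cong-≗ {n} (λ u → length-filterᵇ-tabulate (ascending u) id)))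
    where
    ascendingDegree : Fin n → ℕ
    ascendingDegree u = length (filterᵇ (ascending u) (allFin n))

  𝟙-adj≡ascendingEdge : ∀ u v → 𝟙 (adj G u v) ≡ ascendingEdge u v + ascendingEdge v u
  𝟙-adj≡ascendingEdge u v with ≡⊎<ᵇ-swap≡not (toℕ u) (toℕ v)
  ... | inj₁ u≡v rewrite toℕ-injective u≡v | irrefl G v | ∧-zeroʳ (toℕ v <ᵇ toℕ v) = refl
  ... | inj₂ swap rewrite swap | SimpleGraph.sym G v u = 𝟙-split (toℕ u <ᵇ toℕ v) (adj G u v)

  handshaking : ∑[ v < n ] deg G v ≡ 2 * edgeCount G
  handshaking = begin
    ∑[ v < n ] deg G v
      ≡⟨ sum-cong-≗ {n} deg≡∑ ⟩
    ∑[ v < n ] ∑[ u < n ] 𝟙 (adj G v u)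
      ≡⟨ sum-cong-≗ {n} (λ v → trans (sum-cong-≗ {n} (𝟙-adj≡ascendingEdge v))
                                     (∑-distrib-+ (ascendingEdge v) (λ u → ascendingEdge u v))) ⟩
    ∑[ v < n ] (∑[ u < n ] ascendingEdge v u + ∑[ u < n ] ascendingEdge u v)
      ≡⟨ ∑-distrib-+ {n} (λ v → ∑[ u < n ] ascendingEdge v u) (λ v → ∑[ u < n ] ascendingEdge u v) ⟩
    ∑[ v < n ] ∑[ u < n ] ascendingEdge v u + ∑[ v < n ] ∑[ u < n ] ascendingEdge u v
      ≡⟨ cong (∑[ v < n ] ∑[ u < n ] ascendingEdge v u +_) (∑-comm (λ v u → ascendingEdge u v)) ⟩
    ∑[ v < n ] ∑[ u < n ] ascendingEdge v u + ∑[ u < n ] ∑[ v < n ] ascendingEdge u v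
      ≡⟨ cong (λ m → m + m) (≡.sym edgeCount≡∑) ⟩
    edgeCount G + edgeCount G
      ≡⟨ cong (edgeCount G +_) (≡.sym (+-identityʳ (edgeCount G))) ⟩
    2 * edgeCount G
      ∎
    where open ≡-Reasoning

  lowNbrs≤deg : ∀ v d → lowNbrs G v d ≤ deg G v
  lowNbrs≤deg v d = length-filter (T? ∘ λ u → deg G u ≤ᵇ d) (nbrs G v)

  small big : Fin n → Bool
  small u = deg G u ≤ᵇ 3
  big u = not (deg G u ≤ᵇ 4)

  highNbrs : Fin n → ℕ
  highNbrs v = length (filterᵇ big (nbrs G v))

  deg≡lowNbrs+highNbrs : ∀ v → deg G v ≡ lowNbrs G v 4 + highNbrs v
  deg≡lowNbrs+highNbrs v = length-filterᵇ-partition (λ u → deg G u ≤ᵇ 4) (nbrs G v)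

  gives : Fin n → Fin n → Bool
  gives u v = big u ∧ (adj G u v ∧ small v)

  sent received : Fin n → ℕ
  sent u = ∑[ v < n ] 𝟙 (gives u v)
  received v = ∑[ u < n ] 𝟙 (gives u v)

  sent≡ : ∀ u → sent u ≡ (if big u then lowNbrs G u 3 else 0)
  sent≡ u = trans (∑-𝟙-∧ˡ (big u) (λ v → adj G u v ∧ small v))
                  (cong (λ m → if big u then m else 0) (≡.sym (length-filterᵇ-nbrs u small)))

  received≡ : ∀ v → received v ≡ (if small v then highNbrs v else 0)
  received≡ v = begin
    received v
      ≡⟨ sum-cong-≗ {n} (cong 𝟙 ∘ gives≡) ⟩
    ∑[ u < n ] 𝟙 (small v ∧ (adj G v u ∧ big u))
      ≡⟨ ∑-𝟙-∧ˡ (small v) (λ u → adj G v u ∧ big u) ⟩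
    (if small v then ∑[ u < n ] 𝟙 (adj G v u ∧ big u) else 0)
      ≡⟨ cong (λ m → if small v then m else 0) (≡.sym (length-filterᵇ-nbrs v big)) ⟩
    (if small v then highNbrs v else 0)
      ∎
    where
    open ≡-Reasoning
    gives≡ : ∀ u → gives u v ≡ small v ∧ (adj G v u ∧ big u)
    gives≡ u = trans (x∙yz≈z∙yx (big u) (adj G u v) (small v))
                     (cong (λ b → small v ∧ (b ∧ big u)) (SimpleGraph.sym G u v))

  ∑-sent≡∑-received : ∑[ u < n ] sent u ≡ ∑[ v < n ] received v
  ∑-sent≡∑-received = ∑-comm (λ u v → 𝟙 (gives u v))

  -- The final charges 2 deg v - 8 + received v - sent v are nonnegative,
  -- with everything moved to one side to avoid truncated subtraction.
  discharging : (∀ v → 8 + sent v ≤ 2 * deg G v + received v) → 2 * n ≤ edgeCount G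
  discharging final≥0 = *-cancelˡ-≤ 4 (+-cancelʳ-≤ Σsent _ _ (begin
    4 * (2 * n) + Σsent
      ≡⟨ cong (_+ Σsent) (trans (≡.sym (*-assoc 4 2 n)) (trans (*-comm 8 n) (≡.sym (∑-const n 8)))) ⟩
    ∑[ v < n ] 8 + Σsent
      ≡⟨ ∑-distrib-+ {n} (λ _ → 8) sent ⟨
    ∑[ v < n ] (8 + sent v)
      ≤⟨ ∑-mono-≤ final≥0 ⟩
    ∑[ v < n ] (2 * deg G v + received v)
      ≡⟨ ∑-distrib-+ (λ v → 2 * deg G v) received ⟩
    ∑[ v < n ] (2 * deg G v) + ∑[ v < n ] received v
      ≡⟨ cong₂ _+_ (*-distribˡ-sum 2 (deg G)) ∑-sent≡∑-received ⟨
    2 * ∑[ v < n ] deg G v + Σsent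
      ≡⟨ cong (λ m → 2 * m + Σsent) handshaking ⟩
    2 * (2 * edgeCount G) + Σsent
      ≡⟨ cong (_+ Σsent) (*-assoc 2 2 (edgeCount G)) ⟨
    4 * edgeCount G + Σsent
      ∎))
    where
    open ≤-Reasoning
    Σsent : ℕ
    Σsent = ∑[ u < n ] sent u

Configuration : (d ℓ₃ ℓ₄ : ℕ) → Set
Configuration d ℓ₃ ℓ₄ =
  d ≡ 2 ⊎ (d ≡ 3 × 2 ≤ ℓ₄) ⊎ (d ≡ 5 × 3 ≤ ℓ₃) ⊎ (d ≡ 6 × 5 ≤ ℓ₃) ⊎ (7 ≤ d × ℓ₃ ≡ d)

configuration? : ∀ d ℓ₃ ℓ₄ → Dec (Configuration d ℓ₃ ℓ₄)
configuration? d ℓ₃ ℓ₄ =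
  d ≟ 2 ⊎-dec (d ≟ 3 ×-dec 2 ≤? ℓ₄) ⊎-dec (d ≟ 5 ×-dec 3 ≤? ℓ₃)
        ⊎-dec (d ≟ 6 ×-dec 5 ≤? ℓ₃) ⊎-dec (7 ≤? d ×-dec ℓ₃ ≟ d)

final-charge-nonneg : ∀ {d ℓ₃ ℓ₄ h} → 2 ≤ d → ℓ₃ ≤ d → d ≡ ℓ₄ + h → ¬ Configuration d ℓ₃ ℓ₄ →
  8 + (if not (d ≤ᵇ 4) then ℓ₃ else 0) ≤ 2 * d + (if d ≤ᵇ 3 then h else 0)
final-charge-nonneg {1} (s≤s ()) _ _ _
final-charge-nonneg {2} _ _ _ ¬c = ⊥-elim (¬c (inj₁ refl))
final-charge-nonneg {3} {ℓ₄ = 0} _ _ refl _ = m≤m+n 8 1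
final-charge-nonneg {3} {ℓ₄ = 1} _ _ refl _ = ≤-refl
final-charge-nonneg {3} {ℓ₄ = suc (suc _)} _ _ _ ¬c = ⊥-elim (¬c (inj₂ (inj₁ (refl , s≤s (s≤s z≤n)))))
final-charge-nonneg {4} _ _ _ _ = ≤-refl
final-charge-nonneg {5} _ _ _ ¬c = +-monoʳ-≤ 8 (s≤s⁻¹ (≰⇒> (¬c ∘ inj₂ ∘ inj₂ ∘ inj₁ ∘ (refl ,_))))
final-charge-nonneg {6} _ _ _ ¬c = +-monoʳ-≤ 8 (s≤s⁻¹ (≰⇒> (¬c ∘ inj₂ ∘ inj₂ ∘ inj₂ ∘ inj₁ ∘ (refl ,_))))
final-charge-nonneg {d@(suc (suc (suc (suc (suc (suc (suc _)))))))} _ ℓ₃≤d _ ¬c =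
  m≤n⇒m≤n+o 0 (8+m≤2*n 7≤d (≤∧≢⇒< ℓ₃≤d (¬c ∘ inj₂ ∘ inj₂ ∘ inj₂ ∘ inj₂ ∘ (7≤d ,_))))
  where
  7≤d : 7 ≤ d
  7≤d = s≤s (s≤s (s≤s (s≤s (s≤s (s≤s (s≤s z≤n))))))
  8+m≤2*n : ∀ {m n} → 7 ≤ n → m < n → 8 + m ≤ 2 * n
  8+m≤2*n {m} {n} 7≤n m<n = begin
    7 + suc m ≤⟨ +-mono-≤ 7≤n m<n ⟩
    n + n     ≡⟨ cong (n +_) (+-identityʳ n) ⟨
    2 * n     ∎
    where open ≤-Reasoning

lemma4 : (n : ℕ) (G : SimpleGraph n) →
    edgeCount G + 1 ≤ 2 * n →
    minDegAtLeast G 2 →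
    ∃ λ (v : Fin n) →
    (deg G v ≡ 2)
    ⊎ (deg G v ≡ 3 × 2 ≤ lowNbrs G v 4)
    ⊎ (deg G v ≡ 5 × 3 ≤ lowNbrs G v 3)
    ⊎ (deg G v ≡ 6 × 5 ≤ lowNbrs G v 3)
    ⊎ (7 ≤ deg G v × lowNbrs G v 3 ≡ deg G v)
lemma4 n G sparse δ≥2
  with any? (λ v → configuration? (deg G v) (lowNbrs G v 3) (lowNbrs G v 4))
... | yes found = found
... | no none = ⊥-elim (<⇒≱ edgeCount<2n (discharging G final≥0))
  where
  edgeCount<2n : edgeCount G < 2 * n
  edgeCount<2n = ≡.subst (_≤ 2 * n) (+-comm (edgeCount G) 1) sparse
  final≥0 : ∀ v → 8 + sent G v ≤ 2 * deg G v + received G v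
  final≥0 v rewrite sent≡ G v | received≡ G v =
    final-charge-nonneg (δ≥2 v) (lowNbrs≤deg G v 3) (deg≡lowNbrs+highNbrs G v) (none ∘ (v ,_))
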